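{- Let $x,y,z,a,b$ be nodes (valid clusters) of a top tree satisfying the orientation invariant, with $y$ the parent of $x$ and $a$, and $z$ the parent of $y$ and $b$. If $a$ is a path cluster and $x$ and $y$ hang off to the same side, then $x \cup b$ is not a connected set of edges.
   Context: Let $F$ be a forest (the underlying forest) in which some vertices are marked as exposed. For a set $C$ of edges of $F$, a vertex $w$ is a boundary vertex of $C$ if $w$ is incident to an edge of $C$ and either $w$ is exposed or $w$ is incident to an edge of $F$ not in $C$. A cluster is a nonempty connected set of edges; it is valid if it has at most two boundary vertices; a valid cluster is a path cluster if it has exactly two boundary vertices and a point cluster if it has zero or one. A top tree for a tree $T$ of $F$ (with at least one edge) is a rooted tree in which every internal node has exactly two children and whose leaves are in bijection with the edges of $T$; each node is identified with the cluster consisting of the edges at the leaves of its subtree, and every such cluster is required to be connected and valid. The two children of an internal node share exactly one vertex, its central vertex. Orientation: each internal node has its children ordered as a left child and a right child, and each leaf has the endpoints of its edge ordered as left and right endpoint. For a leaf, a boundary vertex is its left (right) boundary vertex if it is its left (right) endpoint. For an internal node, a boundary vertex is its middle boundary vertex if it equals the central vertex; otherwise it is a left (resp. right) boundary vertex if it is a boundary vertex of the left (resp. right) child. The leftmost boundary vertex of a node is its left boundary vertex if one exists, otherwise its middle boundary vertex if one exists, otherwise it does not exist; rightmost is defined symmetrically. The orientation invariant: for every internal node, the rightmost boundary vertex of its left child and the leftmost boundary vertex of its right child both exist and equal the central vertex of the node. Two nodes hang off to the same side if both are left children or both are right children of their respective parents. -}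

module Defs where

open import Data.Nat using (ℕ)
open import Data.Fin using (Fin)
open import Data.Bool using (Bool; true; false)
open import Data.Product using (_×_; _,_; proj₁; proj₂; ∃; ∃₂)
open import Data.Sum using (_⊎_)
open import Data.Empty using (⊥)
open import Data.Unit using (⊤)
open import Data.List using (List; []; _∷_; _++_)
open import Data.List.Membership.Propositional using (_∈_; _∉_)
open import Data.List.Relation.Unary.Unique.Propositional using (Unique)
open import Relation.Nullary using (¬_)
open import Relation.Binary.PropositionalEquality using (_≡_; _≢_)

record Graph : Set where
  field
    m       : ℕ
    ends    : Fin m → ℕ × ℕ
    exposed : ℕ → Bool

module _ (G : Graph) where
  open Graph G

  Inc : ℕ → Fin m → Set
  Inc w e = w ≡ proj₁ (ends e) ⊎ w ≡ proj₂ (ends e)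

  Joins : Fin m → ℕ → ℕ → Set
  Joins e u w = ends e ≡ (u , w) ⊎ ends e ≡ (w , u)

  data Walk : ℕ → ℕ → List (Fin m) → Set where
    nil  : ∀ {u} → Walk u u []
    cons : ∀ {u w v e es} → Joins e u w → Walk w v es → Walk u v (e ∷ es)

  IsForest : Set
  IsForest = ∀ u es → Walk u u es → Unique es → es ≡ []

  Boundary : List (Fin m) → ℕ → Set
  Boundary C w = (∃ λ e → e ∈ C × Inc w e)
               × (exposed w ≡ true ⊎ (∃ λ e → e ∉ C × Inc w e))

  Adj : Fin m → Fin m → Set
  Adj e e' = ∃ λ w → Inc w e × Inc w e'

  data Linked (C : List (Fin m)) : Fin m → Fin m → Set where
    here : ∀ {e} → Linked C e e
    step : ∀ {e e' e''} → Linked C e e' → e'' ∈ C → Adj e' e'' → Linked C e e''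

  Connected : List (Fin m) → Set
  Connected C = (∃ λ e → e ∈ C) × (∀ e e' → e ∈ C → e' ∈ C → Linked C e e')

  AtMostTwo : (ℕ → Set) → Set
  AtMostTwo P = ∃₂ λ u v → ∀ w → P w → w ≡ u ⊎ w ≡ v

  ExactlyTwo : (ℕ → Set) → Set
  ExactlyTwo P = ∃₂ λ u v → u ≢ v × P u × P v × (∀ w → P w → w ≡ u ⊎ w ≡ v)

  Valid : List (Fin m) → Set
  Valid C = AtMostTwo (Boundary C)

  PathCluster : List (Fin m) → Set
  PathCluster C = ExactlyTwo (Boundary C)

  -- oriented binary trees whose leaves are edges;
  -- leaf e true : left endpoint = proj₁ (ends e); leaf e false : swapped
  data TT : Set where
    leaf : Fin m → Bool → TT
    node : TT → TT → TT

  edgesOf : TT → List (Fin m)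
  edgesOf (leaf e _) = e ∷ []
  edgesOf (node s t) = edgesOf s ++ edgesOf t

  endL : Fin m → Bool → ℕ
  endL e true  = proj₁ (ends e)
  endL e false = proj₂ (ends e)

  endR : Fin m → Bool → ℕ
  endR e true  = proj₂ (ends e)
  endR e false = proj₁ (ends e)

  Shared : TT → TT → ℕ → Set
  Shared s t w = (∃ λ e → e ∈ edgesOf s × Inc w e) × (∃ λ e → e ∈ edgesOf t × Inc w e)

  -- central vertex (children share exactly one vertex, so Shared determines it)
  Central : TT → ℕ → Set
  Central (leaf _ _) w = ⊥
  Central (node s t) w = Shared s t w

  LeftBV : TT → ℕ → Set
  LeftBV (leaf e b) w = Boundary (e ∷ []) w × w ≡ endL e b
  LeftBV (node s t) w = Boundary (edgesOf (node s t)) w × ¬ Shared s t w × Boundary (edgesOf s) w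

  RightBV : TT → ℕ → Set
  RightBV (leaf e b) w = Boundary (e ∷ []) w × w ≡ endR e b
  RightBV (node s t) w = Boundary (edgesOf (node s t)) w × ¬ Shared s t w × Boundary (edgesOf t) w

  MiddleBV : TT → ℕ → Set
  MiddleBV t w = Boundary (edgesOf t) w × Central t w

  Leftmost : TT → ℕ → Set
  Leftmost t w = LeftBV t w ⊎ ((∀ u → ¬ LeftBV t u) × MiddleBV t w)

  Rightmost : TT → ℕ → Set
  Rightmost t w = RightBV t w ⊎ ((∀ u → ¬ RightBV t u) × MiddleBV t w)

  Oriented : TT → Set
  Oriented (leaf _ _) = ⊤
  Oriented (node s t) =
      ((∃ λ w → Rightmost s w) × (∀ w → Rightmost s w → Shared s t w))
    × ((∃ λ w → Leftmost t w) × (∀ w → Leftmost t w → Shared s t w))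

  UniqueCentral : TT → Set
  UniqueCentral (leaf _ _) = ⊤
  UniqueCentral (node s t) = ∃ λ c → Shared s t c × (∀ w → Shared s t w → w ≡ c)

  data _⊑_ : TT → TT → Set where
    here  : ∀ {t} → t ⊑ t
    left  : ∀ {s l r} → s ⊑ l → s ⊑ node l r
    right : ∀ {s l r} → s ⊑ r → s ⊑ node l r

  -- r is a top tree for a tree (connected component) of G,
  -- satisfying the orientation invariant
  OrientedTopTree : TT → Set
  OrientedTopTree r =
      Unique (edgesOf r)
    × (∀ e e' → e ∈ edgesOf r → Adj e e' → e' ∈ edgesOf r)
    × (∀ t → t ⊑ r → Connected (edgesOf t) × Valid (edgesOf t) × UniqueCentral t × Oriented t)

{-# OPTIONS --safe #-}
-- Say y = node x a (the other case is its mirror image).  Since a has two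
-- boundary vertices and y a single central vertex, some boundary vertex d of a
-- is not central in y, hence touches no edge of x and is a right boundary
-- vertex of y.  It is then the rightmost one, so by the orientation invariant
-- at z it is the central vertex of z, the only vertex that y and b share.  If
-- x ∪ b were connected, x and b would share a vertex, which is then shared by
-- y and b, hence equal to d: but d touches no edge of x.
module Submission where

open import Defs
open import Data.Sum using (_⊎_; inj₁; inj₂)
open import Data.List using (List; _++_)
open import Relation.Nullary using (¬_; yes; no)
open import Relation.Binary.PropositionalEquality using (_≡_; refl; sym; trans; subst)
open import Data.Product using (∃; _×_; _,_; proj₁)
open import Data.Empty using (⊥-elim)
open import Data.Fin using (Fin)
open import Data.Nat using (ℕ)
import Data.Nat.Properties as ℕ
open import Data.List.Relation.Unary.Any using (here)
open import Data.List.Membership.Propositional using (_∈_)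
open import Data.List.Membership.Propositional.Properties using (∈-++⁺ˡ; ∈-++⁺ʳ; ∈-++⁻)
open import Data.List.Relation.Binary.Subset.Propositional using (_⊆_)

module _ (G : Graph) where
  open Graph G

  ⊑-trans : ∀ {s t u} → _⊑_ G s t → _⊑_ G t u → _⊑_ G s u
  ⊑-trans p here      = p
  ⊑-trans p (left q)  = left (⊑-trans p q)
  ⊑-trans p (right q) = right (⊑-trans p q)

  edgesOf-nonempty : (t : TT G) → ∃ λ e → e ∈ edgesOf G t
  edgesOf-nonempty (leaf e _) = e , here refl
  edgesOf-nonempty (node s t) with edgesOf-nonempty s
  ... | e , e∈s = e , ∈-++⁺ˡ e∈s

  CommonVertex : List (Fin m) → List (Fin m) → ℕ → Set
  CommonVertex X B w = (∃ λ e → e ∈ X × Inc G w e) × (∃ λ e → e ∈ B × Inc G w e)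

  Linked-++-escape : ∀ X B {e e'} → Linked G (X ++ B) e e' → e ∈ X →
                     e' ∈ X ⊎ ∃ (CommonVertex X B)
  Linked-++-escape X B here e∈X = inj₁ e∈X
  Linked-++-escape X B (step l e''∈ (w , i' , i'')) e∈X
    with Linked-++-escape X B l e∈X
  ... | inj₂ common = inj₂ common
  ... | inj₁ e'∈X with ∈-++⁻ X e''∈
  ...   | inj₁ e''∈X = inj₁ e''∈X
  ...   | inj₂ e''∈B = inj₂ (w , (_ , e'∈X , i') , (_ , e''∈B , i''))

  connected-++⇒shared : ∀ s t → Connected G (edgesOf G s ++ edgesOf G t) → ∃ (Shared G s t)
  connected-++⇒shared s t (_ , linked)
    with edgesOf-nonempty s | edgesOf-nonempty t
  ... | e₀ , e₀∈s | e₁ , e₁∈t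
    with Linked-++-escape (edgesOf G s) (edgesOf G t)
           (linked e₀ e₁ (∈-++⁺ˡ e₀∈s) (∈-++⁺ʳ (edgesOf G s) e₁∈t)) e₀∈s
  ... | inj₂ common = common
  ... | inj₁ e₁∈s = _ , (e₁ , e₁∈s , inj₁ refl) , (e₁ , e₁∈t , inj₁ refl)

  shared-unique : ∀ s t {u v} → UniqueCentral G (node s t) →
                  Shared G s t u → Shared G s t v → u ≡ v
  shared-unique _ _ (_ , _ , unique) su sv = trans (unique _ su) (sym (unique _ sv))

  Boundary-mono : ∀ {A D d} → A ⊆ D → (∀ {e} → e ∈ D → Inc G d e → e ∈ A) →
                  Boundary G A d → Boundary G D d
  Boundary-mono A⊆D _ ((e , e∈A , i) , inj₁ exp) = (e , A⊆D e∈A , i) , inj₁ exp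
  Boundary-mono A⊆D D→A ((e , e∈A , i) , inj₂ (f , f∉A , j)) =
    (e , A⊆D e∈A , i) , inj₂ (f , (λ f∈D → f∉A (D→A f∈D j)) , j)

  PathCluster⇒boundary-avoiding : ∀ {C} {P : ℕ → Set} {c} → PathCluster G C →
                                  (∀ w → P w → w ≡ c) → ∃ λ d → Boundary G C d × ¬ P d
  PathCluster⇒boundary-avoiding {c = c} (u , v , u≢v , Bu , Bv , _) atMostc with u ℕ.≟ c
  ... | yes u≡c = v , Bv , λ Pv → u≢v (trans u≡c (sym (atMostc v Pv)))
  ... | no u≢c  = u , Bu , λ Pu → u≢c (atMostc u Pu)

  boundary⇒RightBV : ∀ s t {d} → Boundary G (edgesOf G t) d → ¬ Shared G s t d →
                     RightBV G (node s t) d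
  boundary⇒RightBV s t {d} Bd d∉ =
    Boundary-mono (∈-++⁺ʳ (edgesOf G s)) incident∈t Bd , d∉ , Bd
    where
    incident∈t : ∀ {e} → e ∈ edgesOf G s ++ edgesOf G t → Inc G d e → e ∈ edgesOf G t
    incident∈t e∈ i with ∈-++⁻ (edgesOf G s) e∈
    ... | inj₁ e∈s = ⊥-elim (d∉ ((_ , e∈s , i) , proj₁ Bd))
    ... | inj₂ e∈t = e∈t

  boundary⇒LeftBV : ∀ s t {d} → Boundary G (edgesOf G s) d → ¬ Shared G s t d →
                    LeftBV G (node s t) d
  boundary⇒LeftBV s t {d} Bd d∉ = Boundary-mono ∈-++⁺ˡ incident∈s Bd , d∉ , Bd
    where
    incident∈s : ∀ {e} → e ∈ edgesOf G s ++ edgesOf G t → Inc G d e → e ∈ edgesOf G s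
    incident∈s e∈ i with ∈-++⁻ (edgesOf G s) e∈
    ... | inj₁ e∈s = e∈s
    ... | inj₂ e∈t = ⊥-elim (d∉ (proj₁ Bd , (_ , e∈t , i)))

  path-left-child-separates : ∀ x a b → UniqueCentral G (node x a) →
    UniqueCentral G (node (node x a) b) → Oriented G (node (node x a) b) →
    PathCluster G (edgesOf G a) → ¬ Connected G (edgesOf G x ++ edgesOf G b)
  path-left-child-separates x a b (_ , _ , atMostc) ucz ((_ , rightmost⇒shared) , _) pc conn
    with PathCluster⇒boundary-avoiding pc atMostc | connected-++⇒shared x b conn
  ... | d , Bd , d∉ | w , (f , f∈x , i) , w∈b =
    d∉ ((f , f∈x , subst (λ v → Inc G v f) w≡d i) , proj₁ Bd)
    where
    w≡d : w ≡ d
    w≡d = shared-unique (node x a) b ucz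
            ((f , ∈-++⁺ˡ f∈x , i) , w∈b)
            (rightmost⇒shared d (inj₁ (boundary⇒RightBV x a Bd d∉)))

  path-right-child-separates : ∀ x a b → UniqueCentral G (node a x) →
    UniqueCentral G (node b (node a x)) → Oriented G (node b (node a x)) →
    PathCluster G (edgesOf G a) → ¬ Connected G (edgesOf G x ++ edgesOf G b)
  path-right-child-separates x a b (_ , _ , atMostc) ucz (_ , (_ , leftmost⇒shared)) pc conn
    with PathCluster⇒boundary-avoiding pc atMostc | connected-++⇒shared x b conn
  ... | d , Bd , d∉ | w , (f , f∈x , i) , w∈b =
    d∉ (proj₁ Bd , (f , f∈x , subst (λ v → Inc G v f) w≡d i))
    where
    w≡d : w ≡ d
    w≡d = shared-unique b (node a x) ucz
            (w∈b , (f , ∈-++⁺ʳ (edgesOf G a) f∈x , i))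
            (leftmost⇒shared d (inj₁ (boundary⇒LeftBV a x Bd d∉)))

lemma4p3 : (G : Graph) → IsForest G → (r : TT G) → OrientedTopTree G r →
    (x a b z : TT G) → _⊑_ G z r →
    (z ≡ node (node x a) b ⊎ z ≡ node b (node a x)) →
    PathCluster G (edgesOf G a) →
    ¬ Connected G (edgesOf G x ++ edgesOf G b)
lemma4p3 G _ r (_ , _ , nodes) x a b z z⊑r (inj₁ refl) pc
  with nodes _ (⊑-trans G (left here) z⊑r) | nodes z z⊑r
... | (_ , _ , ucy , _) | (_ , _ , ucz , oz) = path-left-child-separates G x a b ucy ucz oz pc
lemma4p3 G _ r (_ , _ , nodes) x a b z z⊑r (inj₂ refl) pc
  with nodes _ (⊑-trans G (right here) z⊑r) | nodes z z⊑r
... | (_ , _ , ucy , _) | (_ , _ , ucz , oz) = path-right-child-separates G x a b ucy ucz oz pc
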